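{- Let $P$ be a finite poset with Hasse diagram $H$, let $c$ be a chain of $H$ with vertex set $V_c$, and let $P_1,\dots,P_n$ be the posets associated with the $n$ regions of $H$ with respect to $c$. Let $i,j$ be two different elements of $P$. Then $$\mu_P(i,j)=\begin{cases}-1&\text{if } i\prec j \text{ (i.e. }(i,j)\text{ is an edge of }H),\\ \sum_{k=1}^n\mu_{P_k}(i,j)&\text{otherwise,}\end{cases}$$ with the convention $\mu_Q(i,j)=0$ if $i\notin Q$ or $j\notin Q$.
   Context: The Hasse diagram of a poset $P$ is the directed graph on $P$ with an edge $(a,b)$ whenever $b$ covers $a$. A chain of a directed graph is a sequence of edges $(e_1,\dots,e_k)$ with the end of $e_i$ equal to the origin of $e_{i+1}$, all edges and vertices distinct; $V_c$ includes its origin and end. Regions: for each connected component $H_k$ of the subgraph of $H$ induced on $P\setminus V_c$, the region is the subgraph of $H$ induced on $V(H_k)\cup V_c$; $P_k$ is the poset on the vertex set of this region whose order is the reflexive-transitive closure of its edges. $\mu_Q$ denotes the Möbius function of a poset $Q$ (with $\mu_Q(i,j)=0$ when $i\not\le_Q j$). -}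

module Defs where

open import Level using (0ℓ)
open import Data.Nat using (ℕ; zero; suc)
open import Data.Fin using (Fin; zero; suc; inject₁; _<?_)
open import Data.Fin.Properties using (_≟_)
open import Data.Bool using (Bool; true; false; _∧_; _∨_; not; if_then_else_)
open import Data.Integer using (ℤ; 0ℤ; 1ℤ; -_; _+_)
open import Relation.Binary using (Rel; IsDecPartialOrder)
open import Relation.Binary.PropositionalEquality using (_≡_)
open import Relation.Nullary.Decidable using (⌊_⌋)
open import Function.Definitions using (Injective)

_==_ : ∀ {m} → Fin m → Fin m → Bool
a == b = ⌊ a ≟ b ⌋

anyᵇ : ∀ {n} → (Fin n → Bool) → Bool
anyᵇ {zero}  p = false
anyᵇ {suc n} p = p zero ∨ anyᵇ (λ x → p (suc x))

sumℤ : ∀ {n} → (Fin n → ℤ) → ℤ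
sumℤ {zero}  f = 0ℤ
sumℤ {suc n} f = f zero + sumℤ (λ x → f (suc x))

record FinPoset (m : ℕ) : Set₁ where
  field
    _≤P_ : Rel (Fin m) 0ℓ
    isDecPartialOrder : IsDecPartialOrder _≡_ _≤P_
  open IsDecPartialOrder isDecPartialOrder public using () renaming (_≤?_ to _≤P?_)

  leᵇ : Fin m → Fin m → Bool
  leᵇ a b = ⌊ a ≤P? b ⌋

open FinPoset public

-- Defined by the usual recursion
--   μ(i,i) = 1,  μ(i,j) = - Σ_{i ≤ k < j} μ(i,k)  (i < j),  μ(i,j) = 0 otherwise,
-- computed with fuel; fuel m suffices for any partial order on ≤ m
-- elements (recursion depth is bounded by the length of a chain).

möbFuel : ∀ {m} → (Fin m → Fin m → Bool) → ℕ → Fin m → Fin m → ℤ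
möbFuel le zero    i j = 0ℤ
möbFuel le (suc f) i j =
  if i == j then 1ℤ
  else if le i j
       then - sumℤ (λ k → if le i k ∧ le k j ∧ not (k == j)
                            then möbFuel le f i k else 0ℤ)
       else 0ℤ

möbius : ∀ {m} → (Fin m → Fin m → Bool) → Fin m → Fin m → ℤ
möbius {m} le = möbFuel le m

μ : ∀ {m} → FinPoset m → Fin m → Fin m → ℤ
μ P = möbius (leᵇ P)

ltᵇ : ∀ {m} → FinPoset m → Fin m → Fin m → Bool
ltᵇ P a b = leᵇ P a b ∧ not (a == b)

edge : ∀ {m} → FinPoset m → Fin m → Fin m → Bool
edge P a b = ltᵇ P a b ∧ not (anyᵇ (λ c → ltᵇ P a c ∧ ltᵇ P c b))

-- Walks: `walkᵇ E f a b` = there is a walk from a to b along E of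
-- length ≤ f.  With f = m this is the reflexive-transitive closure of E.

walkᵇ : ∀ {m} → (Fin m → Fin m → Bool) → ℕ → Fin m → Fin m → Bool
walkᵇ E zero    a b = a == b
walkᵇ E (suc f) a b = (a == b) ∨ anyᵇ (λ c → E a c ∧ walkᵇ E f c b)

closure : ∀ {m} → (Fin m → Fin m → Bool) → Fin m → Fin m → Bool
closure {m} E = walkᵇ E m

-- Chains of the Hasse diagram: vertex sequence v₀,…,v_{k+1} (k+1 ≥ 1
-- edges), all vertices distinct (hence all edges distinct), consecutive
-- vertices joined by a Hasse edge.

record Chain {m : ℕ} (P : FinPoset m) : Set where
  field
    len      : ℕ                              -- number of edges = suc len
    vert     : Fin (suc (suc len)) → Fin m
    distinct : Injective _≡_ _≡_ vert
    isEdge   : ∀ (t : Fin (suc len)) → edge P (vert (inject₁ t)) (vert (suc t)) ≡ true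

open Chain public

inVc : ∀ {m} {P : FinPoset m} → Chain P → Fin m → Bool
inVc c x = anyᵇ (λ t → vert c t == x)

module _ {m : ℕ} (P : FinPoset m) (c : Chain P) where

  -- undirected Hasse edges of the subgraph induced on P ∖ V_c
  outEdge : Fin m → Fin m → Bool
  outEdge a b = not (inVc c a) ∧ not (inVc c b) ∧ (edge P a b ∨ edge P b a)

  -- x lies in the connected component H(v) of v in H[P ∖ V_c]
  -- (meaningful when v ∉ V_c)
  inComp : Fin m → Fin m → Bool
  inComp v x = not (inVc c v) ∧ not (inVc c x) ∧ closure outEdge v x

  -- v is the canonical representative (least index) of its component
  isRep : Fin m → Bool
  isRep v = not (inVc c v) ∧ not (anyᵇ (λ u → ⌊ u <? v ⌋ ∧ inComp v u))

  -- vertex set of the region of component H(v): V(H(v)) ∪ V_c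
  inRegion : Fin m → Fin m → Bool
  inRegion v x = inComp v x ∨ inVc c x

  regionEdge : Fin m → Fin m → Fin m → Bool
  regionEdge v a b = inRegion v a ∧ inRegion v b ∧ edge P a b

  regionLe : Fin m → Fin m → Fin m → Bool
  regionLe v = closure (regionEdge v)

  μRegion : Fin m → Fin m → Fin m → ℤ
  μRegion v i j = if inRegion v i ∧ inRegion v j then möbius (regionLe v) i j else 0ℤ

  -- Σ_k μ_{P_k}(i,j): one summand per connected component of H[P ∖ V_c]
  regionSum : Fin m → Fin m → ℤ
  regionSum i j = sumℤ (λ v → if isRep v then μRegion v i j else 0ℤ)

-- A row g = μ_Q(i,·) of a Möbius function is characterised by
-- g(i) = 1, g(j) = 0 for j ≱ i and Σ_{i ≤ z ≤ j} g(z) = 0 for j > i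
-- (module MöbiusRow, which also relates this to the fuelled recursion of
-- Defs).  So it suffices to check these conditions for the right-hand
-- side F of the theorem.  The geometric input is that the order of a
-- region P_k is the restriction of the order of P, since a Hasse walk
-- leaving the region must cross the chain and can be rerouted along it
-- (RegionOrder).  Consequently the region rows are rows for P inside the
-- region, and over an interval [i,x] leaving the region they sum to 0 or
-- 1 according to whether the chain meets (i,x] (RegionMöbius).  If i is
-- off the chain, F is the row of i's own region; if i is on the chain, F
-- is the sum of all region rows plus a correction at i and at the chain
-- successor of i, and the interval sums cancel by counting regions
-- (MainArgument).

module Submission where

open import Level using (0ℓ)
open import Function using (_∘_)
open import Data.Nat as ℕ using (ℕ; zero; suc; z≤n; s≤s)
import Data.Nat.Properties as ℕP
open import Data.Fin as Fin using (Fin; zero; suc; inject₁; _<?_)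
import Data.Fin.Properties as FinP
open import Data.Bool using (Bool; true; false; _∧_; _∨_; not; if_then_else_)
open import Data.Bool.Properties using (∧-assoc; ∧-zeroʳ; ∧-identityʳ)
open import Data.Integer using (ℤ; 0ℤ; 1ℤ; -_; _+_)
import Data.Integer.Properties as ℤP
open import Data.Integer.Tactic.RingSolver using (solve-∀)
open import Algebra.Properties.AbelianGroup ℤP.+-0-abelianGroup using (inverseʳ-unique)
open import Algebra.Properties.CommutativeMonoid.Sum ℤP.+-0-commutativeMonoid
  using (sum; ∑-distrib-+; ∑-comm; sum-cong-≗; sum-replicate-zero)
open import Data.Unit using (⊤)
open import Data.Product using (Σ; _×_; _,_; proj₁; proj₂)
open import Data.Sum using (_⊎_; inj₁; inj₂)
open import Data.Empty using (⊥; ⊥-elim)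
open import Relation.Nullary using (yes; no)
open import Relation.Nullary.Decidable using (⌊_⌋)
open import Relation.Binary using (Rel; IsDecPartialOrder; tri<; tri≈; tri>)
open import Relation.Binary.PropositionalEquality
open import Relation.Binary.Construct.Closure.ReflexiveTransitive
  using (Star; ε; _◅_; _◅◅_; fold; reverse)
open import Defs

∧-l : ∀ {a b} → a ∧ b ≡ true → a ≡ true
∧-l {true} _ = refl

∧-r : ∀ {a b} → a ∧ b ≡ true → b ≡ true
∧-r {true} e = e

∧-intro : ∀ {a b} → a ≡ true → b ≡ true → a ∧ b ≡ true
∧-intro refl refl = refl

∨-elim : ∀ {a b} → a ∨ b ≡ true → a ≡ true ⊎ b ≡ true
∨-elim {true} _ = inj₁ refl
∨-elim {false} e = inj₂ e

∨-introˡ : ∀ {a b} → a ≡ true → a ∨ b ≡ true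
∨-introˡ refl = refl

∨-introʳ : ∀ {a b} → b ≡ true → a ∨ b ≡ true
∨-introʳ {true} _ = refl
∨-introʳ {false} e = e

∨-false-intro : ∀ {a b} → a ≡ false → b ≡ false → a ∨ b ≡ false
∨-false-intro refl refl = refl

not-true : ∀ {a} → not a ≡ true → a ≡ false
not-true {false} _ = refl

not-intro : ∀ {a} → a ≡ false → not a ≡ true
not-intro refl = refl

true≢false : ∀ {a} → a ≡ true → a ≡ false → ⊥
true≢false refl ()

¬true : ∀ {a} → (a ≡ true → ⊥) → a ≡ false
¬true {true} h = ⊥-elim (h refl)
¬true {false} _ = refl

¬false : ∀ {a} → (a ≡ false → ⊥) → a ≡ true
¬false {true} _ = refl
¬false {false} h = ⊥-elim (h refl)

caseBool : ∀ {A : Set} (b : Bool) → (b ≡ true → A) → (b ≡ false → A) → A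
caseBool true t f = t refl
caseBool false t f = f refl

bool-ext : ∀ {a b} → (a ≡ true → b ≡ true) → (b ≡ true → a ≡ true) → a ≡ b
bool-ext {true} f g = sym (f refl)
bool-ext {false} {true} f g = g refl
bool-ext {false} {false} f g = refl

if-true : ∀ {A : Set} {b} {x y : A} → b ≡ true → (if b then x else y) ≡ x
if-true refl = refl

if-false : ∀ {A : Set} {b} {x y : A} → b ≡ false → (if b then x else y) ≡ y
if-false refl = refl

module _ {m : ℕ} where

  ==-refl : (a : Fin m) → a == a ≡ true
  ==-refl a with a FinP.≟ a
  ... | yes _ = refl
  ... | no a≢a = ⊥-elim (a≢a refl)

  ==→≡ : {a b : Fin m} → a == b ≡ true → a ≡ b
  ==→≡ {a} {b} e with a FinP.≟ b
  ... | yes a≡b = a≡b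
  ==→≡ () | no _

  ≢→== : {a b : Fin m} → a ≢ b → a == b ≡ false
  ≢→== {a} {b} a≢b with a FinP.≟ b
  ... | yes a≡b = ⊥-elim (a≢b a≡b)
  ... | no _ = refl

<?-intro : ∀ {m} {u v : Fin m} → u Fin.< v → ⌊ u <? v ⌋ ≡ true
<?-intro {u = u} {v} u<v with u <? v
... | yes _ = refl
... | no u≮v = ⊥-elim (u≮v u<v)

<?-elim : ∀ {m} {u v : Fin m} → ⌊ u <? v ⌋ ≡ true → u Fin.< v
<?-elim {u = u} {v} h with u <? v
... | yes u<v = u<v
<?-elim () | no _

any-intro : ∀ {n} (p : Fin n → Bool) (x : Fin n) → p x ≡ true → anyᵇ p ≡ true
any-intro p zero e = ∨-introˡ e
any-intro p (suc x) e = ∨-introʳ {p zero} (any-intro (p ∘ suc) x e)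

any-elim : ∀ {n} (p : Fin n → Bool) → anyᵇ p ≡ true → Σ (Fin n) (λ x → p x ≡ true)
any-elim {suc n} p e with ∨-elim {p zero} e
... | inj₁ h = zero , h
... | inj₂ h with any-elim (p ∘ suc) h
... | x , hx = suc x , hx

any-false : ∀ {n} (p : Fin n → Bool) → anyᵇ p ≡ false → (x : Fin n) → p x ≡ false
any-false p e x = ¬true (λ h → true≢false (any-intro p x h) e)

-- Sums.  [ b ]· x is x if b holds and 0 otherwise, and Σ[ A ] f is the
-- sum of f over the subset A; both unfold to the shapes used in Defs.
-- sumℤ agrees with the library sum over the additive monoid of ℤ, so
-- the library's summation laws apply.

[_]·_ : Bool → ℤ → ℤ
[ b ]· x = if b then x else 0ℤ

Σ[_]_ : ∀ {n} → (Fin n → Bool) → (Fin n → ℤ) → ℤ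
Σ[ A ] f = sumℤ (λ z → [ A z ]· f z)

sumℤ≡sum : ∀ {n} (f : Fin n → ℤ) → sumℤ f ≡ sum f
sumℤ≡sum {zero} f = refl
sumℤ≡sum {suc n} f = cong (f zero +_) (sumℤ≡sum (f ∘ suc))

sum-cong : ∀ {n} {f g : Fin n → ℤ} → (∀ x → f x ≡ g x) → sumℤ f ≡ sumℤ g
sum-cong {f = f} {g} f≗g =
  trans (sumℤ≡sum f) (trans (sum-cong-≗ f≗g) (sym (sumℤ≡sum g)))

sum-+ : ∀ {n} (f g : Fin n → ℤ) → sumℤ (λ x → f x + g x) ≡ sumℤ f + sumℤ g
sum-+ f g = trans (sumℤ≡sum (λ x → f x + g x)) (trans (∑-distrib-+ f g)
  (sym (cong₂ _+_ (sumℤ≡sum f) (sumℤ≡sum g))))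

sum-swap : ∀ {n k} (f : Fin n → Fin k → ℤ) →
  sumℤ (λ x → sumℤ (f x)) ≡ sumℤ (λ y → sumℤ (λ x → f x y))
sum-swap f = begin
    sumℤ (λ x → sumℤ (f x))        ≡⟨ sum-cong (λ x → sumℤ≡sum (f x)) ⟩
    sumℤ (λ x → sum (f x))         ≡⟨ sumℤ≡sum (λ x → sum (f x)) ⟩
    sum (λ x → sum (f x))          ≡⟨ ∑-comm f ⟩
    sum (λ y → sum (λ x → f x y))  ≡⟨ sym (sumℤ≡sum (λ y → sum (λ x → f x y))) ⟩
    sumℤ (λ y → sum (λ x → f x y)) ≡⟨ sum-cong (λ y → sym (sumℤ≡sum (λ x → f x y))) ⟩
    sumℤ (λ y → sumℤ (λ x → f x y)) ∎
  where open ≡-Reasoning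

sum-zero : ∀ {n} {f : Fin n → ℤ} → (∀ x → f x ≡ 0ℤ) → sumℤ f ≡ 0ℤ
sum-zero {n} f≗0 = trans (sum-cong f≗0) (trans (sumℤ≡sum {n} (λ _ → 0ℤ)) (sum-replicate-zero n))

sum-neg : ∀ {n} (f : Fin n → ℤ) → sumℤ (λ x → - f x) ≡ - sumℤ f
sum-neg {zero} f = refl
sum-neg {suc n} f = trans (cong (- f zero +_) (sum-neg (f ∘ suc)))
  (sym (ℤP.neg-distrib-+ (f zero) _))

sum-single : ∀ {n} (f : Fin n → ℤ) (a : Fin n) → (∀ x → x ≢ a → f x ≡ 0ℤ) → sumℤ f ≡ f a
sum-single {suc n} f zero h =
  trans (cong (f zero +_) (sum-zero (λ x → h (suc x) (λ ())))) (ℤP.+-identityʳ (f zero))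
sum-single {suc n} f (suc a) h =
  trans (cong₂ _+_ (h zero (λ ())) (sum-single (f ∘ suc) a (λ x x≢a → h (suc x) (x≢a ∘ FinP.suc-injective))))
        (ℤP.+-identityˡ _)

[]·-zero : ∀ (b : Bool) {x : ℤ} → x ≡ 0ℤ → [ b ]· x ≡ 0ℤ
[]·-zero true e = e
[]·-zero false e = refl

[]·-cong : ∀ (b : Bool) {x y : ℤ} → (b ≡ true → x ≡ y) → [ b ]· x ≡ [ b ]· y
[]·-cong true h = h refl
[]·-cong false h = refl

[]·-+ : ∀ (b : Bool) (x y : ℤ) → [ b ]· (x + y) ≡ [ b ]· x + [ b ]· y
[]·-+ true x y = refl
[]·-+ false x y = refl

Σ-cong : ∀ {n} (A : Fin n → Bool) {f g : Fin n → ℤ} →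
  (∀ z → A z ≡ true → f z ≡ g z) → Σ[ A ] f ≡ Σ[ A ] g
Σ-cong A f≗g = sum-cong (λ z → []·-cong (A z) (f≗g z))

Σ-+ : ∀ {n} (A : Fin n → Bool) (f g : Fin n → ℤ) →
  Σ[ A ] (λ z → f z + g z) ≡ Σ[ A ] f + Σ[ A ] g
Σ-+ A f g = trans (sum-cong (λ z → []·-+ (A z) (f z) (g z))) (sum-+ (λ z → [ A z ]· f z) (λ z → [ A z ]· g z))

Σ-neg : ∀ {n} (A : Fin n → Bool) (f : Fin n → ℤ) → Σ[ A ] (λ z → - f z) ≡ - Σ[ A ] f
Σ-neg A f = trans (sum-cong (λ z → neg-inside (A z))) (sum-neg (λ z → [ A z ]· f z))
  where
  neg-inside : ∀ b {x} → [ b ]· (- x) ≡ - ([ b ]· x)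
  neg-inside true = refl
  neg-inside false = refl

Σ-swap : ∀ {n k} (A : Fin n → Bool) (B : Fin k → Bool) (h : Fin n → Fin k → ℤ) →
  Σ[ A ] (λ z → Σ[ B ] (h z)) ≡ Σ[ B ] (λ v → Σ[ A ] (λ z → h z v))
Σ-swap A B h = begin
    sumℤ (λ z → [ A z ]· sumℤ (λ v → [ B v ]· h z v))
  ≡⟨ sum-cong (λ z → scale-inside (A z) (λ v → [ B v ]· h z v)) ⟩
    sumℤ (λ z → sumℤ (λ v → [ A z ]· [ B v ]· h z v))
  ≡⟨ sum-swap (λ z v → [ A z ]· [ B v ]· h z v) ⟩
    sumℤ (λ v → sumℤ (λ z → [ A z ]· [ B v ]· h z v))
  ≡⟨ sum-cong (λ v → trans (sum-cong (λ z → commute (A z) (B v)))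
                           (sym (scale-inside (B v) (λ z → [ A z ]· h z v)))) ⟩
    sumℤ (λ v → [ B v ]· sumℤ (λ z → [ A z ]· h z v)) ∎
  where
  open ≡-Reasoning
  scale-inside : ∀ {k} b (f : Fin k → ℤ) → [ b ]· sumℤ f ≡ sumℤ (λ v → [ b ]· f v)
  scale-inside true f = refl
  scale-inside {k} false f = sym (sum-zero {k} (λ _ → refl))
  commute : ∀ a b {x} → [ a ]· [ b ]· x ≡ [ b ]· [ a ]· x
  commute true b = refl
  commute false true = refl
  commute false false = refl

Σ-subset : ∀ {n} (A B : Fin n → Bool) (f : Fin n → ℤ) →
  (∀ z → f z ≢ 0ℤ → A z ≡ B z) → Σ[ A ] f ≡ Σ[ B ] f
Σ-subset A B f h = sum-cong pointwise
  where
  pointwise : ∀ z → [ A z ]· f z ≡ [ B z ]· f z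
  pointwise z with f z ℤP.≟ 0ℤ
  ... | yes fz≡0 = trans ([]·-zero (A z) fz≡0) (sym ([]·-zero (B z) fz≡0))
  ... | no fz≢0 = cong (λ b → [ b ]· f z) (h z fz≢0)

Σ-zero : ∀ {n} (A : Fin n → Bool) {f : Fin n → ℤ} →
  (∀ z → A z ≡ true → f z ≡ 0ℤ) → Σ[ A ] f ≡ 0ℤ
Σ-zero A h = sum-zero (λ z → caseBool (A z) (λ Az → trans (if-true Az) (h z Az)) if-false)

Σ-single : ∀ {n} (A : Fin n → Bool) (f : Fin n → ℤ) (w : Fin n) → A w ≡ true →
  (∀ z → A z ≡ true → z ≢ w → f z ≡ 0ℤ) → Σ[ A ] f ≡ f w
Σ-single A f w Aw vanish = trans (sum-single _ w off-w) (if-true Aw)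
  where
  off-w : ∀ z → z ≢ w → [ A z ]· f z ≡ 0ℤ
  off-w z z≢w = caseBool (A z) (λ Az → trans (if-true Az) (vanish z Az z≢w)) if-false

Σ-remove : ∀ {n} (A : Fin n → Bool) (f : Fin n → ℤ) (w : Fin n) → A w ≡ true →
  Σ[ A ] f ≡ Σ[ (λ z → A z ∧ not (z == w)) ] f + f w
Σ-remove A f w Aw = begin
    Σ[ A ] f
  ≡⟨ sum-cong (λ z → split (A z) (z == w) (f z) (λ z=w → subst (λ t → A t ≡ true) (sym (==→≡ z=w)) Aw)) ⟩
    sumℤ (λ z → [ A z ∧ not (z == w) ]· f z + [ z == w ]· f z)
  ≡⟨ sum-+ (λ z → [ A z ∧ not (z == w) ]· f z) (λ z → [ z == w ]· f z) ⟩
    Σ[ (λ z → A z ∧ not (z == w)) ] f + Σ[ (λ z → z == w) ] f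
  ≡⟨ cong (Σ[ (λ z → A z ∧ not (z == w)) ] f +_)
          (Σ-single (_== w) f w (==-refl w) (λ z z=w z≢w → ⊥-elim (z≢w (==→≡ z=w)))) ⟩
    Σ[ (λ z → A z ∧ not (z == w)) ] f + f w ∎
  where
  open ≡-Reasoning
  split : ∀ (a e : Bool) (x : ℤ) → (e ≡ true → a ≡ true) →
    [ a ]· x ≡ [ a ∧ not e ]· x + [ e ]· x
  split true true x _ = sym (ℤP.+-identityˡ x)
  split true false x _ = sym (ℤP.+-identityʳ x)
  split false true x h with h refl
  ... | ()
  split false false x _ = refl

-- The number of elements of a Boolean subset of Fin n.  It serves as a
-- termination measure: for the depth of intervals and for simple walks.

count : ∀ {n} → (Fin n → Bool) → ℕ
count {zero} p = 0
count {suc n} p = (if p zero then 1 else 0) ℕ.+ count (p ∘ suc)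

count-mono : ∀ {n} (p q : Fin n → Bool) → (∀ x → p x ≡ true → q x ≡ true) →
  count p ℕ.≤ count q
count-mono {zero} p q p⊆q = z≤n
count-mono {suc n} p q p⊆q with p zero in p0 | q zero in q0
... | true | true = s≤s (count-mono _ _ (p⊆q ∘ suc))
... | false | true = ℕP.m≤n⇒m≤1+n (count-mono _ _ (p⊆q ∘ suc))
... | false | false = count-mono _ _ (p⊆q ∘ suc)
... | true | false = ⊥-elim (true≢false (p⊆q zero p0) q0)

count-strict : ∀ {n} (p q : Fin n → Bool) → (∀ x → p x ≡ true → q x ≡ true) →
  (y : Fin n) → q y ≡ true → p y ≡ false → count p ℕ.< count q
count-strict {suc n} p q p⊆q zero qy py rewrite py | qy = s≤s (count-mono _ _ (p⊆q ∘ suc))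
count-strict {suc n} p q p⊆q (suc y) qy py with p zero in p0 | q zero in q0
... | true | true = s≤s (count-strict _ _ (p⊆q ∘ suc) y qy py)
... | false | true = ℕP.m≤n⇒m≤1+n (count-strict _ _ (p⊆q ∘ suc) y qy py)
... | false | false = count-strict _ _ (p⊆q ∘ suc) y qy py
... | true | false = ⊥-elim (true≢false (p⊆q zero p0) q0)

count-nonempty : ∀ {n} (p : Fin n → Bool) (y : Fin n) → p y ≡ true → 0 ℕ.< count p
count-nonempty {suc n} p zero py rewrite py = s≤s z≤n
count-nonempty {suc n} p (suc y) py =
  ℕP.<-≤-trans (count-nonempty (p ∘ suc) y py) (ℕP.m≤n+m _ (if p zero then 1 else 0))

count≤size : ∀ {n} (p : Fin n → Bool) → count p ℕ.≤ n
count≤size {zero} p = z≤n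
count≤size {suc n} p with p zero
... | true = s≤s (count≤size _)
... | false = ℕP.m≤n⇒m≤1+n (count≤size _)

count<size : ∀ {n} (p : Fin n → Bool) (y : Fin n) → p y ≡ false → count p ℕ.< n
count<size {n} p y py =
  ℕP.<-≤-trans (count-strict p (λ _ → true) (λ _ _ → refl) y refl py) (count≤size {n} (λ _ → true))

-- With the given fuel the
-- recursion has stabilised (its depth is bounded by m), so the row
-- μ(i,·) has the classical characterisation: it is the unique g with g(i) = 1,
-- g(j) = 0 for j ≱ i, and Σ_{i ≤ z ≤ j} g(z) = 0 for every j > i.

module MöbiusRow {m : ℕ} (le : Fin m → Fin m → Bool)
  (le-refl : ∀ a → le a a ≡ true)
  (le-trans : ∀ {a b c} → le a b ≡ true → le b c ≡ true → le a c ≡ true)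
  (le-anti : ∀ {a b} → le a b ≡ true → le b a ≡ true → a ≡ b)
  (i : Fin m) where

  below : Fin m → Fin m → Bool
  below j k = le i k ∧ le k j ∧ not (k == j)

  interval : Fin m → Fin m → Bool
  interval j z = le i z ∧ le z j

  unfold : (Fin m → ℤ) → Fin m → ℤ
  unfold g j = if i == j then 1ℤ else if le i j then - Σ[ below j ] g else 0ℤ

  not-below-self : ∀ j → below j j ≡ false
  not-below-self j with le i j | le j j
  ... | false | _ = refl
  ... | true | true rewrite ==-refl j = refl
  ... | true | false = refl

  -- the recursion at j only looks at the depth of [i, j), which
  -- decreases along it and is smaller than m
  depth : Fin m → ℕ
  depth j = count (below j)

  depth<m : ∀ j → depth j ℕ.< m
  depth<m j = count<size (below j) j (not-below-self j)

  depth-decreases : ∀ j k → below j k ≡ true → depth k ℕ.< depth j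
  depth-decreases j k k∈[i,j⟩ = count-strict (below k) (below j) [i,k⟩⊆[i,j⟩ k k∈[i,j⟩ (not-below-self k)
    where
    k≤j : le k j ≡ true
    k≤j = ∧-l (∧-r {le i k} k∈[i,j⟩)
    k≢j : k ≢ j
    k≢j refl = true≢false (==-refl k) (not-true (∧-r {le k k} (∧-r {le i k} k∈[i,j⟩)))
    [i,k⟩⊆[i,j⟩ : ∀ z → below k z ≡ true → below j z ≡ true
    [i,k⟩⊆[i,j⟩ z z∈[i,k⟩ = ∧-intro {le i z} (∧-l {le i z} z∈[i,k⟩) (∧-intro {le z j} z≤j (not-intro (≢→== z≢j)))
      where
      z≤k : le z k ≡ true
      z≤k = ∧-l (∧-r {le i z} z∈[i,k⟩)
      z≤j : le z j ≡ true
      z≤j = le-trans z≤k k≤j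
      z≢j : z ≢ j
      z≢j refl = k≢j (le-anti k≤j z≤k)

  unfold-cong : ∀ (g h : Fin m → ℤ) j → (∀ k → below j k ≡ true → g k ≡ h k) →
    unfold g j ≡ unfold h j
  unfold-cong g h j g≗h = cong (λ t → if i == j then 1ℤ else if le i j then - t else 0ℤ)
    (Σ-cong (below j) (g≗h))

  fuel-stable : ∀ f f' j → depth j ℕ.< f → depth j ℕ.< f' → möbFuel le f i j ≡ möbFuel le f' i j
  fuel-stable (suc f) (suc f') j (s≤s d≤f) (s≤s d≤f') =
    unfold-cong (möbFuel le f i) (möbFuel le f' i) j (λ k k<j →
      fuel-stable f f' k (ℕP.<-≤-trans (depth-decreases j k k<j) d≤f)
                         (ℕP.<-≤-trans (depth-decreases j k k<j) d≤f'))

  fuel-unfold : ∀ f j → depth j ℕ.< f → möbFuel le f i j ≡ unfold (möbFuel le f i) j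
  fuel-unfold (suc f) j (s≤s d≤f) =
    unfold-cong (möbFuel le f i) (möbFuel le (suc f) i) j (λ k k<j →
      let dk<f = ℕP.<-≤-trans (depth-decreases j k k<j) d≤f
      in fuel-stable f (suc f) k dk<f (ℕP.m<n⇒m<1+n dk<f))

  möbius-unfold : ∀ j → möbius le i j ≡ unfold (möbius le i) j
  möbius-unfold j = fuel-unfold m j (depth<m j)

  unfold-unique : (g : Fin m → ℤ) → (∀ j → g j ≡ unfold g j) → ∀ j → möbius le i j ≡ g j
  unfold-unique g g-fix j = go m j (depth<m j)
    where
    go : ∀ f j → depth j ℕ.< f → möbFuel le f i j ≡ g j
    go (suc f) j (s≤s d≤f) = trans
      (unfold-cong (möbFuel le f i) g j (λ k k<j → go f k (ℕP.<-≤-trans (depth-decreases j k k<j) d≤f)))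
      (sym (g-fix j))

  record IsMöbiusRow (g : Fin m → ℤ) : Set where
    field
      at-start     : g i ≡ 1ℤ
      off-interval : ∀ j → le i j ≡ false → g j ≡ 0ℤ
      interval-sum : ∀ j → le i j ≡ true → i ≢ j → Σ[ interval j ] g ≡ 0ℤ

  interval-split : ∀ g j → le i j ≡ true → Σ[ interval j ] g ≡ Σ[ below j ] g + g j
  interval-split g j i≤j = trans (Σ-remove (interval j) g j (∧-intro i≤j (le-refl j)))
    (cong (_+ g j) (sum-cong (λ z → cong ([_]· g z) (∧-assoc (le i z) (le z j) (not (z == j))))))

  row-fixpoint : ∀ g → IsMöbiusRow g → ∀ j → g j ≡ unfold g j
  row-fixpoint g row j with i == j in i=j | le i j in i≤j
  ... | true | _ = trans (cong g (sym (==→≡ i=j))) at-start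
    where open IsMöbiusRow row
  ... | false | false = off-interval j i≤j
    where open IsMöbiusRow row
  ... | false | true = inverseʳ-unique (Σ[ below j ] g) (g j)
    (trans (sym (interval-split g j i≤j)) (interval-sum j i≤j i≢j))
    where
    open IsMöbiusRow row
    i≢j : i ≢ j
    i≢j refl = true≢false (==-refl i) i=j

  möbius-row : IsMöbiusRow (möbius le i)
  möbius-row = record
    { at-start = trans (möbius-unfold i) (if-true (==-refl i))
    ; off-interval = λ j i≰j → trans (möbius-unfold j)
        (trans (if-false (≢→== {a = i} {j} (λ { refl → true≢false (le-refl i) i≰j }))) (if-false i≰j))
    ; interval-sum = λ j i≤j i≢j → begin
        Σ[ interval j ] (möbius le i)
          ≡⟨ interval-split (möbius le i) j i≤j ⟩
        Σ[ below j ] (möbius le i) + möbius le i j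
          ≡⟨ cong (Σ[ below j ] (möbius le i) +_)
               (trans (möbius-unfold j) (trans (if-false {b = i == j} (≢→== i≢j)) (if-true i≤j))) ⟩
        Σ[ below j ] (möbius le i) + - Σ[ below j ] (möbius le i)
          ≡⟨ ℤP.+-inverseʳ (Σ[ below j ] (möbius le i)) ⟩
        0ℤ ∎
    }
    where open ≡-Reasoning

  row-unique : ∀ g → IsMöbiusRow g → ∀ j → möbius le i j ≡ g j
  row-unique g row = unfold-unique g (row-fixpoint g row)

  row-cover : ∀ g → IsMöbiusRow g → ∀ j → le i j ≡ true → i ≢ j →
    (∀ k → le i k ≡ true → le k j ≡ true → k ≡ i ⊎ k ≡ j) → g j ≡ - 1ℤ
  row-cover g row j i≤j i≢j covers = begin
      g j    ≡⟨ inverseʳ-unique (g i) (g j) gi+gj≡0 ⟩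
      - g i  ≡⟨ cong -_ at-start ⟩
      - 1ℤ   ∎
    where
    open ≡-Reasoning
    open IsMöbiusRow row
    only-i : ∀ k → below j k ≡ true → k ≡ i
    only-i k k∈[i,j⟩ with covers k (∧-l k∈[i,j⟩) (∧-l (∧-r {le i k} k∈[i,j⟩))
    ... | inj₁ k≡i = k≡i
    ... | inj₂ refl = ⊥-elim (true≢false k∈[i,j⟩ (not-below-self k))
    below-j≡gi : Σ[ below j ] g ≡ g i
    below-j≡gi = Σ-single (below j) g i (∧-intro (le-refl i) (∧-intro i≤j (not-intro (≢→== i≢j))))
      (λ k k∈[i,j⟩ k≢i → ⊥-elim (k≢i (only-i k k∈[i,j⟩)))
    gi+gj≡0 : g i + g j ≡ 0ℤ
    gi+gj≡0 = trans (cong (_+ g j) (sym below-j≡gi))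
      (trans (sym (interval-split g j i≤j)) (interval-sum j i≤j i≢j))

-- Walks along a Boolean edge relation E.  `closure E` (from Defs) only
-- looks at walks of length ≤ m; since every walk can be shortened to a
-- simple one, it is exactly reachability along E.

Walk : ∀ {m} → (Fin m → Fin m → Bool) → Rel (Fin m) 0ℓ
Walk E = Star (λ a b → E a b ≡ true)

module Reachability {m : ℕ} {E : Fin m → Fin m → Bool} where

  steps : ∀ {a b} → Walk E a b → ℕ
  steps ε = 0
  steps (_ ◅ w) = suc (steps w)

  walkᵇ-complete : ∀ {a b} (w : Walk E a b) f → steps w ℕ.≤ f → walkᵇ E f a b ≡ true
  walkᵇ-complete {a} ε zero _ = ==-refl a
  walkᵇ-complete {a} ε (suc f) _ = ∨-introˡ (==-refl a)
  walkᵇ-complete {a} {b} (_◅_ {j = c} e w) (suc f) (s≤s n≤f) =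
    ∨-introʳ {a == b} (any-intro (λ x → E a x ∧ walkᵇ E f x b) c (∧-intro {E a c} e (walkᵇ-complete w f n≤f)))

  walkᵇ-sound : ∀ f a b → walkᵇ E f a b ≡ true → Walk E a b
  walkᵇ-sound zero a b a=b rewrite ==→≡ a=b = ε
  walkᵇ-sound (suc f) a b h with ∨-elim {a == b} h
  ... | inj₁ a=b rewrite ==→≡ a=b = ε
  ... | inj₂ h' with any-elim (λ x → E a x ∧ walkᵇ E f x b) h'
  ... | c , hc = ∧-l {E a c} hc ◅ walkᵇ-sound f c b (∧-r {E a c} hc)

  visits : ∀ {a b} → Walk E a b → Fin m → Bool
  visits {a} ε x = a == x
  visits {a} (_ ◅ w) x = (a == x) ∨ visits w x

  Simple : ∀ {a b} → Walk E a b → Set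
  Simple ε = ⊤
  Simple {a} (_ ◅ w) = (visits w a ≡ false) × Simple w

  simple-short : ∀ {a b} (w : Walk E a b) → Simple w → steps w ℕ.< count (visits w)
  simple-short {a} ε _ = count-nonempty (visits {a} ε) a (==-refl a)
  simple-short {a} (e ◅ w) (a∉w , simple) = ℕP.<-≤-trans (s≤s (simple-short w simple))
    (count-strict (visits w) (visits (e ◅ w)) (λ x → ∨-introʳ {a == x}) a (∨-introˡ (==-refl a)) a∉w)

  suffixFrom : ∀ {c b} (w : Walk E c b) → Simple w → ∀ x → visits w x ≡ true → Σ (Walk E x b) Simple
  suffixFrom ε simple x c=x rewrite ==→≡ c=x = ε , simple
  suffixFrom {c} (e ◅ w) simple x x∈w with c == x in c=x
  ... | true rewrite ==→≡ c=x = e ◅ w , simple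
  ... | false = suffixFrom w (proj₂ simple) x x∈w

  simplify : ∀ {a b} → Walk E a b → Σ (Walk E a b) Simple
  simplify ε = ε , _
  simplify {a} (e ◅ w) with simplify w
  ... | w' , simple with visits w' a in a∈w'
  ... | true = suffixFrom w' simple a a∈w'
  ... | false = e ◅ w' , (a∈w' , simple)

  closure-complete : ∀ {a b} → Walk E a b → closure E a b ≡ true
  closure-complete w with simplify w
  ... | w' , simple = walkᵇ-complete w' m
    (ℕP.<⇒≤ (ℕP.<-≤-trans (simple-short w' simple) (count≤size (visits w'))))

  closure-sound : ∀ {a b} → closure E a b ≡ true → Walk E a b
  closure-sound {a} {b} = walkᵇ-sound m a b

open Reachability public

module PosetFacts {m : ℕ} (P : FinPoset m) where
  private module P = IsDecPartialOrder (isDecPartialOrder P)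

  le-refl : ∀ a → leᵇ P a a ≡ true
  le-refl a with a P.≤? a
  ... | yes _ = refl
  ... | no a≰a = ⊥-elim (a≰a P.refl)

  le→≤ : ∀ {a b} → leᵇ P a b ≡ true → _≤P_ P a b
  le→≤ {a} {b} h with a P.≤? b
  ... | yes a≤b = a≤b
  le→≤ () | no _

  ≤→le : ∀ {a b} → _≤P_ P a b → leᵇ P a b ≡ true
  ≤→le {a} {b} a≤b with a P.≤? b
  ... | yes _ = refl
  ... | no a≰b = ⊥-elim (a≰b a≤b)

  le-trans : ∀ {a b c} → leᵇ P a b ≡ true → leᵇ P b c ≡ true → leᵇ P a c ≡ true
  le-trans h h' = ≤→le (P.trans (le→≤ h) (le→≤ h'))

  le-anti : ∀ {a b} → leᵇ P a b ≡ true → leᵇ P b a ≡ true → a ≡ b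
  le-anti h h' = P.antisym (le→≤ h) (le→≤ h')

  lt-le : ∀ {a b} → ltᵇ P a b ≡ true → leᵇ P a b ≡ true
  lt-le {a} {b} = ∧-l {leᵇ P a b}

  lt-ne : ∀ {a b} → ltᵇ P a b ≡ true → a ≢ b
  lt-ne {a} h refl = true≢false (==-refl a) (not-true (∧-r {leᵇ P a a} h))

  lt-intro : ∀ {a b} → leᵇ P a b ≡ true → a ≢ b → ltᵇ P a b ≡ true
  lt-intro a≤b a≢b = ∧-intro a≤b (not-intro (≢→== a≢b))

  edge-lt : ∀ {a b} → edge P a b ≡ true → ltᵇ P a b ≡ true
  edge-lt {a} {b} = ∧-l {ltᵇ P a b}

  edge-le : ∀ {a b} → edge P a b ≡ true → leᵇ P a b ≡ true
  edge-le = lt-le ∘ edge-lt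

  edge-ne : ∀ {a b} → edge P a b ≡ true → a ≢ b
  edge-ne = lt-ne ∘ edge-lt

  edge-covers : ∀ {a b k} → edge P a b ≡ true → leᵇ P a k ≡ true → leᵇ P k b ≡ true → k ≡ a ⊎ k ≡ b
  edge-covers {a} {b} {k} e a≤k k≤b with k FinP.≟ a | k FinP.≟ b
  ... | yes k≡a | _ = inj₁ k≡a
  ... | no _ | yes k≡b = inj₂ k≡b
  ... | no k≢a | no k≢b = ⊥-elim (true≢false
    (any-intro (λ x → ltᵇ P a x ∧ ltᵇ P x b) k (∧-intro (lt-intro a≤k (k≢a ∘ sym)) (lt-intro k≤b k≢b)))
    (not-true (∧-r {ltᵇ P a b} e)))

  non-edge-between : ∀ {a b} → ltᵇ P a b ≡ true → edge P a b ≡ false →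
    Σ (Fin m) (λ k → ltᵇ P a k ≡ true × ltᵇ P k b ≡ true)
  non-edge-between {a} {b} a<b no-edge with any-elim (λ x → ltᵇ P a x ∧ ltᵇ P x b) (between a<b no-edge)
    where
    between : ∀ {x y} → x ≡ true → x ∧ not y ≡ false → y ≡ true
    between {true} {true} _ _ = refl
  ... | k , hk = k , ∧-l {ltᵇ P a k} hk , ∧-r {ltᵇ P a k} hk

  closedInterval : Fin m → Fin m → Fin m → Bool
  closedInterval a b z = leᵇ P a z ∧ leᵇ P z b

  subinterval : ∀ {a b a' b'} → leᵇ P a a' ≡ true → leᵇ P b' b ≡ true →
    ∀ z → closedInterval a' b' z ≡ true → closedInterval a b z ≡ true
  subinterval {a} {b} {a'} a≤a' b'≤b z z∈[a',b'] = ∧-intro {leᵇ P a z}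
    (le-trans a≤a' (∧-l {leᵇ P a' z} z∈[a',b'])) (le-trans (∧-r {leᵇ P a' z} z∈[a',b']) b'≤b)

  walk-le : ∀ {E : Fin m → Fin m → Bool} → (∀ {a b} → E a b ≡ true → leᵇ P a b ≡ true) →
    ∀ {a b} → Walk E a b → leᵇ P a b ≡ true
  walk-le E⊆≤ = fold (λ a b → leᵇ P a b ≡ true) (le-trans ∘ E⊆≤) (λ {a} → le-refl a)

  -- conversely a ≤ b is witnessed by a walk in the Hasse diagram, by
  -- induction on the size of the interval [a, b]
  interval-size : Fin m → Fin m → ℕ
  interval-size a b = count (closedInterval a b)

  le→hasse-walk : ∀ {a b} → leᵇ P a b ≡ true → Walk (edge P) a b
  le→hasse-walk {a} {b} = go (suc (interval-size a b)) a b ℕP.≤-refl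
    where
    go : ∀ f a b → interval-size a b ℕ.< f → leᵇ P a b ≡ true → Walk (edge P) a b
    go (suc f) a b (s≤s size≤f) a≤b with a FinP.≟ b
    ... | yes refl = ε
    ... | no a≢b with edge P a b in e
    ...   | true = e ◅ ε
    ...   | false with non-edge-between (lt-intro a≤b a≢b) e
    ...     | k , a<k , k<b = go f a k (ℕP.<-≤-trans lower size≤f) (lt-le a<k)
                       ◅◅ go f k b (ℕP.<-≤-trans upper size≤f) (lt-le k<b)
      where
      lower : interval-size a k ℕ.< interval-size a b
      lower = count-strict _ _ (subinterval (le-refl a) (lt-le k<b))
        b (∧-intro {leᵇ P a b} a≤b (le-refl b))
        (¬true (λ b∈[a,k] → lt-ne k<b (le-anti (lt-le k<b) (∧-r {leᵇ P a b} b∈[a,k]))))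
      upper : interval-size k b ℕ.< interval-size a b
      upper = count-strict _ _ (subinterval (lt-le a<k) (le-refl b))
        a (∧-intro {leᵇ P a a} (le-refl a) a≤b)
        (¬true (λ a∈[k,b] → lt-ne a<k (le-anti (lt-le a<k) (∧-l {leᵇ P k a} a∈[k,b]))))

largest : ∀ {n} (p : Fin n → Bool) t → p t ≡ true →
  Σ (Fin n) (λ t' → p t' ≡ true × (∀ u → p u ≡ true → u Fin.≤ t'))
largest {suc n} p t pt with anyᵇ (p ∘ suc) in later
... | true with any-elim (p ∘ suc) later
...   | t₁ , pt₁ with largest (p ∘ suc) t₁ pt₁
...     | t₂ , pt₂ , max = suc t₂ , pt₂ , λ { zero _ → z≤n ; (suc u) pu → s≤s (max u pu) }
largest {suc n} p zero p0 | false =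
  zero , p0 , λ { zero _ → z≤n ; (suc u) pu → ⊥-elim (true≢false pu (any-false (p ∘ suc) later u)) }
largest {suc n} p (suc t) pt | false = ⊥-elim (true≢false pt (any-false (p ∘ suc) later t))

smallest : ∀ {n} (p : Fin n → Bool) t → p t ≡ true →
  Σ (Fin n) (λ t' → p t' ≡ true × (∀ u → p u ≡ true → t' Fin.≤ u))
smallest {suc n} p t pt with p zero in p0
... | true = zero , p0 , λ _ _ → z≤n
smallest {suc n} p zero pt | false = ⊥-elim (true≢false pt p0)
smallest {suc n} p (suc t) pt | false with smallest (p ∘ suc) t pt
... | t₂ , pt₂ , min = suc t₂ , pt₂ , λ { zero pu → ⊥-elim (true≢false pu p0) ; (suc u) pu → s≤s (min u pu) }

module ChainFacts {m : ℕ} (P : FinPoset m) (c : Chain P) where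
  open PosetFacts P

  on-chain : ∀ t → inVc c (vert c t) ≡ true
  on-chain t = any-intro (λ s → vert c s == vert c t) t (==-refl (vert c t))

  chain-index : ∀ {x} → inVc c x ≡ true → Σ (Fin (suc (suc (len c)))) (λ t → vert c t ≡ x)
  chain-index {x} x∈c with any-elim (λ s → vert c s == x) x∈c
  ... | t , vt=x = t , ==→≡ vt=x

  chain-walk : (E : Fin m → Fin m → Bool) → (∀ t → E (vert c (inject₁ t)) (vert c (suc t)) ≡ true) →
    ∀ s t → s Fin.≤ t → Walk E (vert c s) (vert c t)
  chain-walk E chain⊆E = along (suc (len c)) (vert c) chain⊆E
    where
    along : ∀ n (f : Fin (suc n) → Fin m) → (∀ t → E (f (inject₁ t)) (f (suc t)) ≡ true) →
      ∀ s t → s Fin.≤ t → Walk E (f s) (f t)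
    along n f steps zero zero _ = ε
    along (suc n) f steps zero (suc t) _ = steps zero ◅ along n (f ∘ suc) (steps ∘ suc) zero t z≤n
    along (suc n) f steps (suc s) (suc t) (s≤s s≤t) = along n (f ∘ suc) (steps ∘ suc) s t s≤t

  chain-le : ∀ s t → s Fin.≤ t → leᵇ P (vert c s) (vert c t) ≡ true
  chain-le s t s≤t = walk-le edge-le (chain-walk (edge P) (isEdge c) s t s≤t)

  chain-le-index : ∀ s t → leᵇ P (vert c s) (vert c t) ≡ true → s Fin.≤ t
  chain-le-index s t vs≤vt with FinP.≤-total s t
  ... | inj₁ s≤t = s≤t
  ... | inj₂ t≤s = ℕP.≤-reflexive (cong Fin.toℕ (distinct c (le-anti vs≤vt (chain-le t s t≤s))))

  chain-total : ∀ {x y} → inVc c x ≡ true → inVc c y ≡ true → leᵇ P x y ≡ true ⊎ leᵇ P y x ≡ true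
  chain-total x∈c y∈c with chain-index x∈c | chain-index y∈c
  ... | s , refl | t , refl with FinP.≤-total s t
  ... | inj₁ s≤t = inj₁ (chain-le s t s≤t)
  ... | inj₂ t≤s = inj₂ (chain-le t s t≤s)

  chain-walk-between : (E : Fin m → Fin m → Bool) → (∀ t → E (vert c (inject₁ t)) (vert c (suc t)) ≡ true) →
    ∀ {x y} → inVc c x ≡ true → inVc c y ≡ true → leᵇ P x y ≡ true → Walk E x y
  chain-walk-between E chain⊆E x∈c y∈c x≤y with chain-index x∈c | chain-index y∈c
  ... | s , refl | t , refl = chain-walk E chain⊆E s t (chain-le-index s t x≤y)

  chainAbove : Fin m → Fin m → Bool
  chainAbove i x = anyᵇ (λ u → inVc c u ∧ ltᵇ P i u ∧ leᵇ P u x)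

  chainAbove-intro : ∀ {i x} u → inVc c u ≡ true → ltᵇ P i u ≡ true → leᵇ P u x ≡ true → chainAbove i x ≡ true
  chainAbove-intro {i} {x} u u∈c i<u u≤x =
    any-intro (λ u → inVc c u ∧ ltᵇ P i u ∧ leᵇ P u x) u (∧-intro {inVc c u} u∈c (∧-intro {ltᵇ P i u} i<u u≤x))

  chainAbove-elim : ∀ {i x} → chainAbove i x ≡ true →
    Σ (Fin m) (λ u → inVc c u ≡ true × ltᵇ P i u ≡ true × leᵇ P u x ≡ true)
  chainAbove-elim {i} {x} h with any-elim (λ u → inVc c u ∧ ltᵇ P i u ∧ leᵇ P u x) h
  ... | u , hu = u , ∧-l {inVc c u} hu , ∧-l {ltᵇ P i u} i<u≤x , ∧-r {ltᵇ P i u} i<u≤x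
    where
    i<u≤x : ltᵇ P i u ∧ leᵇ P u x ≡ true
    i<u≤x = ∧-r {inVc c u} hu

  chain-successor : ∀ {i x} → inVc c i ≡ true → chainAbove i x ≡ true →
    Σ (Fin m) (λ z → inVc c z ≡ true × edge P i z ≡ true × leᵇ P z x ≡ true)
  chain-successor {i} {x} i∈c above with chainAbove-elim above
  ... | u , u∈c , i<u , u≤x = first-step (chain-walk-between chainEdge chain-edges i∈c u∈c (lt-le i<u))
    where
    chainEdge : Fin m → Fin m → Bool
    chainEdge a b = edge P a b ∧ inVc c b
    chain-edges : ∀ t → chainEdge (vert c (inject₁ t)) (vert c (suc t)) ≡ true
    chain-edges t = ∧-intro {edge P _ _} (isEdge c t) (on-chain (suc t))
    first-step : Walk chainEdge i u → Σ (Fin m) (λ z → inVc c z ≡ true × edge P i z ≡ true × leᵇ P z x ≡ true)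
    first-step ε = ⊥-elim (lt-ne i<u refl)
    first-step (_◅_ {j = z} e w) = z , ∧-r {edge P i z} e , ∧-l {edge P i z} e ,
      le-trans (walk-le (λ {a} {b} h → edge-le (∧-l {edge P a b} h)) w) u≤x

  chain-cover-unique : ∀ {i z z'} → inVc c z ≡ true → inVc c z' ≡ true →
    edge P i z ≡ true → edge P i z' ≡ true → z ≡ z'
  chain-cover-unique z∈c z'∈c e e' with chain-total z∈c z'∈c
  ... | inj₁ z≤z' with edge-covers e' (edge-le e) z≤z'
  ...   | inj₁ z≡i = ⊥-elim (edge-ne e (sym z≡i))
  ...   | inj₂ z≡z' = z≡z'
  chain-cover-unique z∈c z'∈c e e' | inj₂ z'≤z with edge-covers e (edge-le e') z'≤z
  ...   | inj₁ z'≡i = ⊥-elim (edge-ne e' (sym z'≡i))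
  ...   | inj₂ z'≡z = sym z'≡z

  chain-max-below : ∀ {x u} → inVc c u ≡ true → leᵇ P u x ≡ true →
    Σ (Fin m) (λ w → inVc c w ≡ true × leᵇ P w x ≡ true ×
                     (∀ y → inVc c y ≡ true → leᵇ P y x ≡ true → leᵇ P y w ≡ true))
  chain-max-below {x} u∈c u≤x with chain-index u∈c
  ... | s , refl with largest (λ t → leᵇ P (vert c t) x) s u≤x
  ... | t , vt≤x , max = vert c t , on-chain t , vt≤x , below-max
    where
    below-max : ∀ y → inVc c y ≡ true → leᵇ P y x ≡ true → leᵇ P y (vert c t) ≡ true
    below-max y y∈c y≤x with chain-index y∈c
    ... | r , refl = chain-le r t (max r y≤x)

module ComponentFacts {m : ℕ} (P : FinPoset m) (c : Chain P) where

  outEdge-sym : ∀ {a b} → outEdge P c a b ≡ true → outEdge P c b a ≡ true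
  outEdge-sym {a} {b} h with inVc c a | inVc c b | edge P a b | edge P b a
  ... | false | false | true | y = ∨-introʳ {y} refl
  ... | false | false | false | true = refl

  outEdge-intro : ∀ {a b} → inVc c a ≡ false → inVc c b ≡ false → edge P a b ≡ true → outEdge P c a b ≡ true
  outEdge-intro a∉c b∉c e rewrite a∉c | b∉c | e = refl

  comp-base∉c : ∀ {v x} → inComp P c v x ≡ true → inVc c v ≡ false
  comp-base∉c {v} h = not-true (∧-l {not (inVc c v)} h)

  comp∉c : ∀ {v x} → inComp P c v x ≡ true → inVc c x ≡ false
  comp∉c {v} {x} h = not-true (∧-l {not (inVc c x)} (∧-r {not (inVc c v)} h))

  comp-walk : ∀ {v x} → inComp P c v x ≡ true → Walk (outEdge P c) v x
  comp-walk {v} {x} h = closure-sound (∧-r {not (inVc c x)} (∧-r {not (inVc c v)} h))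

  comp-intro : ∀ {v x} → inVc c v ≡ false → inVc c x ≡ false → Walk (outEdge P c) v x → inComp P c v x ≡ true
  comp-intro v∉c x∉c w rewrite v∉c | x∉c = closure-complete w

  comp-refl : ∀ {x} → inVc c x ≡ false → inComp P c x x ≡ true
  comp-refl x∉c = comp-intro x∉c x∉c ε

  comp-sym : ∀ {v x} → inComp P c v x ≡ true → inComp P c x v ≡ true
  comp-sym h = comp-intro (comp∉c h) (comp-base∉c h) (reverse outEdge-sym (comp-walk h))

  comp-trans : ∀ {u v x} → inComp P c u v ≡ true → inComp P c v x ≡ true → inComp P c u x ≡ true
  comp-trans h h' = comp-intro (comp-base∉c h) (comp∉c h') (comp-walk h ◅◅ comp-walk h')

  comp-neighbour : ∀ {v a b} → inComp P c v a ≡ true → inVc c b ≡ false →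
    edge P a b ≡ true ⊎ edge P b a ≡ true → inComp P c v b ≡ true
  comp-neighbour {v} {a} {b} h b∉c e = comp-trans h (comp-intro a∉c b∉c (joined e ◅ ε))
    where
    a∉c : inVc c a ≡ false
    a∉c = comp∉c h
    joined : edge P a b ≡ true ⊎ edge P b a ≡ true → outEdge P c a b ≡ true
    joined (inj₁ ab) = outEdge-intro a∉c b∉c ab
    joined (inj₂ ba) = outEdge-sym (outEdge-intro b∉c a∉c ba)

  rep-minimal : ∀ {v u} → isRep P c v ≡ true → u Fin.< v → inComp P c v u ≡ true → ⊥
  rep-minimal {v} {u} h u<v u∈H = true≢false
    (any-intro (λ u → ⌊ u <? v ⌋ ∧ inComp P c v u) u (∧-intro {⌊ u <? v ⌋} (<?-intro u<v) u∈H))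
    (not-true (∧-r {not (inVc c v)} h))

  rep-exists : ∀ {x} → inVc c x ≡ false → Σ (Fin m) (λ v → isRep P c v ≡ true × inComp P c v x ≡ true)
  rep-exists {x} x∉c with smallest (inComp P c x) x (comp-refl x∉c)
  ... | v , x~v , min = v , ∧-intro {not (inVc c v)} (not-intro (comp∉c x~v)) (not-intro no-smaller) , comp-sym x~v
    where
    no-smaller : anyᵇ (λ u → ⌊ u <? v ⌋ ∧ inComp P c v u) ≡ false
    no-smaller = ¬true λ h → let (u , hu) = any-elim (λ u → ⌊ u <? v ⌋ ∧ inComp P c v u) h in
      ℕP.<⇒≱ (<?-elim (∧-l {⌊ u <? v ⌋} hu)) (min u (comp-trans x~v (∧-r {⌊ u <? v ⌋} hu)))

  rep-unique : ∀ {v v' x} → isRep P c v ≡ true → isRep P c v' ≡ true →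
    inComp P c v x ≡ true → inComp P c v' x ≡ true → v ≡ v'
  rep-unique {v} {v'} r r' h h' with FinP.<-cmp v v'
  ... | tri< v<v' _ _ = ⊥-elim (rep-minimal r' v<v' (comp-trans h' (comp-sym h)))
  ... | tri≈ _ v≡v' _ = v≡v'
  ... | tri> _ _ v'<v = ⊥-elim (rep-minimal r v'<v (comp-trans h (comp-sym h')))

  -- a vertex x outside V_c lies in exactly one component, so a sum over
  -- representatives whose terms vanish for components missing x reduces
  -- to the term of x's component
  sum-over-reps : ∀ {x v} → isRep P c v ≡ true → inComp P c v x ≡ true → (h : Fin m → ℤ) →
    (∀ v' → isRep P c v' ≡ true → inComp P c v' x ≡ false → h v' ≡ 0ℤ) →
    Σ[ isRep P c ] h ≡ h v
  sum-over-reps {x} {v} rep x∈H h vanish = Σ-single (isRep P c) h v rep others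
    where
    others : ∀ v' → isRep P c v' ≡ true → v' ≢ v → h v' ≡ 0ℤ
    others v' rep' v'≢v = vanish v' rep' (¬true (λ x∈H' → v'≢v (rep-unique rep' rep x∈H' x∈H)))

-- The
-- key structural fact: its order (reachability along the Hasse edges
-- inside Q) is the restriction of the order of P, because a Hasse walk
-- leaving Q must pass through V_c and can be replaced by a walk along
-- the chain.

module RegionOrder {m : ℕ} (P : FinPoset m) (c : Chain P) (v : Fin m) where
  open PosetFacts P
  open ChainFacts P c
  open ComponentFacts P c

  Q : Fin m → Bool
  Q = inRegion P c v

  chain⊆region : ∀ {x} → inVc c x ≡ true → Q x ≡ true
  chain⊆region {x} = ∨-introʳ {inComp P c v x}

  region-comp : ∀ {x} → Q x ≡ true → inVc c x ≡ false → inComp P c v x ≡ true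
  region-comp {x} h x∉c with ∨-elim {inComp P c v x} h
  ... | inj₁ x∈H = x∈H
  ... | inj₂ x∈c = ⊥-elim (true≢false x∈c x∉c)

  neighbour-in-region : ∀ {a b} → Q a ≡ true → inVc c a ≡ false →
    edge P a b ≡ true ⊎ edge P b a ≡ true → Q b ≡ true
  neighbour-in-region {a} {b} qa a∉c e = caseBool (inVc c b) chain⊆region
    (λ b∉c → ∨-introˡ (comp-neighbour (region-comp qa a∉c) b∉c e))

  region-edge : ∀ {a b} → Q a ≡ true → Q b ≡ true → edge P a b ≡ true → regionEdge P c v a b ≡ true
  region-edge qa qb e = ∧-intro qa (∧-intro qb e)

  chain-edges-in-region : ∀ t → regionEdge P c v (vert c (inject₁ t)) (vert c (suc t)) ≡ true
  chain-edges-in-region t = region-edge (chain⊆region (on-chain _)) (chain⊆region (on-chain _)) (isEdge c t)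

  escape : ∀ {d b} (w : Walk (edge P) d b) → Q d ≡ false → Q b ≡ true →
    Σ (Fin m) (λ u → inVc c u ≡ true × leᵇ P d u ≡ true ×
                     Σ (Walk (edge P) u b) (λ w' → steps w' ℕ.≤ steps w))
  escape ε qd qb = ⊥-elim (true≢false qb qd)
  escape {d} (_◅_ {j = d'} e w) qd qb with inVc c d' in d'∈c
  ... | true = d' , d'∈c , edge-le e , w , ℕP.n≤1+n _
  ... | false with Q d' in qd'
  ...   | true = ⊥-elim (true≢false (neighbour-in-region qd' d'∈c (inj₂ e)) qd)
  ...   | false with escape w qd' qb
  ...     | u , u∈c , d'≤u , w' , shorter = u , u∈c , le-trans (edge-le e) d'≤u , w' , ℕP.m≤n⇒m≤1+n shorter

  reroute : ∀ f {a b} (w : Walk (edge P) a b) → steps w ℕ.< f → Q a ≡ true → Q b ≡ true →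
    Walk (regionEdge P c v) a b
  reroute f ε _ qa qb = ε
  reroute (suc f) {a} (_◅_ {j = d} e w) (s≤s short) qa qb with Q d in qd
  ... | true = region-edge qa qd e ◅ reroute f w short qd qb
  ... | false with escape w qd qb
  ...   | u , u∈c , d≤u , w' , shorter =
          chain-walk-between (regionEdge P c v) chain-edges-in-region a∈c u∈c (le-trans (edge-le e) d≤u)
          ◅◅ reroute f w' (ℕP.≤-<-trans shorter short) (chain⊆region u∈c) qb
    where
    a∈c : inVc c a ≡ true
    a∈c = ¬false (λ a∉c → true≢false (neighbour-in-region qa a∉c (inj₁ e)) qd)

  region-le-sound : ∀ {a b} → regionLe P c v a b ≡ true → leᵇ P a b ≡ true
  region-le-sound = walk-le (λ {a} {b} h → edge-le (∧-r {Q b} (∧-r {Q a} h))) ∘ closure-sound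

  region-le-complete : ∀ {a b} → Q a ≡ true → Q b ≡ true → leᵇ P a b ≡ true → regionLe P c v a b ≡ true
  region-le-complete {a} {b} qa qb a≤b = closure-complete (reroute _ w (ℕP.n<1+n (steps w)) qa qb)
    where
    w : Walk (edge P) a b
    w = le→hasse-walk a≤b

  region-le-exact : ∀ {a b} → Q a ≡ true → Q b ≡ true → regionLe P c v a b ≡ leᵇ P a b
  region-le-exact qa qb = bool-ext region-le-sound (region-le-complete qa qb)

  region-le-inside : ∀ {a b} → regionLe P c v a b ≡ true → Q a ≡ true → Q b ≡ true
  region-le-inside = stays ∘ closure-sound
    where
    stays : ∀ {a b} → Walk (regionEdge P c v) a b → Q a ≡ true → Q b ≡ true
    stays ε qa = qa
    stays (_◅_ {i = a} {j = d} e w) _ = stays w (∧-l {Q d} (∧-r {Q a} e))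

  region-le-refl : ∀ a → regionLe P c v a a ≡ true
  region-le-refl a = closure-complete {a = a} ε

  region-le-trans : ∀ {a b d} → regionLe P c v a b ≡ true → regionLe P c v b d ≡ true → regionLe P c v a d ≡ true
  region-le-trans h h' = closure-complete (closure-sound {E = regionEdge P c v} h ◅◅ closure-sound h')

  region-le-anti : ∀ {a b} → regionLe P c v a b ≡ true → regionLe P c v b a ≡ true → a ≡ b
  region-le-anti h h' = le-anti (region-le-sound h) (region-le-sound h')

  exit : ∀ {z x} → Q z ≡ true → Q x ≡ false → leᵇ P z x ≡ true →
    Σ (Fin m) (λ u → inVc c u ≡ true × leᵇ P z u ≡ true × leᵇ P u x ≡ true)
  exit qz qx z≤x = along (le→hasse-walk z≤x) qz qx
    where
    along : ∀ {z x} → Walk (edge P) z x → Q z ≡ true → Q x ≡ false →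
      Σ (Fin m) (λ u → inVc c u ≡ true × leᵇ P z u ≡ true × leᵇ P u x ≡ true)
    along ε qz qx = ⊥-elim (true≢false qz qx)
    along {z} (e ◅ w) qz qx = caseBool (inVc c z)
      (λ z∈c → z , z∈c , le-refl z , walk-le edge-le (e ◅ w))
      (λ z∉c → let (u , u∈c , d≤u , u≤x) = along w (neighbour-in-region qz z∉c (inj₁ e)) qx
               in u , u∈c , le-trans (edge-le e) d≤u , u≤x)

module RegionMöbius {m : ℕ} (P : FinPoset m) (c : Chain P) (v i : Fin m)
  (i∈Q : inRegion P c v i ≡ true) where
  open PosetFacts P
  open ChainFacts P c
  open RegionOrder P c v
  open MöbiusRow (regionLe P c v) region-le-refl region-le-trans region-le-anti i
  private module Row = IsMöbiusRow möbius-row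

  G : Fin m → ℤ
  G = μRegion P c v i

  G-inside : ∀ {z} → Q z ≡ true → G z ≡ möbius (regionLe P c v) i z
  G-inside qz = if-true (∧-intro i∈Q qz)

  G-outside : ∀ {z} → Q z ≡ false → G z ≡ 0ℤ
  G-outside {z} qz = if-false (subst (λ b → Q i ∧ b ≡ false) (sym qz) (∧-zeroʳ (Q i)))

  G-support : ∀ {z} → G z ≢ 0ℤ → Q z ≡ true
  G-support Gz≢0 = ¬false (Gz≢0 ∘ G-outside)

  G-start : G i ≡ 1ℤ
  G-start = trans (G-inside i∈Q) Row.at-start

  G-not-above : ∀ z → leᵇ P i z ≡ false → G z ≡ 0ℤ
  G-not-above z i≰z = caseBool (Q z)
    (λ qz → trans (G-inside qz) (Row.off-interval z (trans (region-le-exact i∈Q qz) i≰z)))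
    G-outside

  -- summing over an interval of P inside the region is summing over the
  -- corresponding interval of the region
  G-interval : ∀ w → Q w ≡ true → ltᵇ P i w ≡ true → Σ[ closedInterval i w ] G ≡ 0ℤ
  G-interval w qw i<w = trans (sum-cong same-terms)
    (Row.interval-sum w (trans (region-le-exact i∈Q qw) (lt-le i<w)) (lt-ne i<w))
    where
    same-terms : ∀ z → [ closedInterval i w z ]· G z ≡ [ interval w z ]· möbius (regionLe P c v) i z
    same-terms z = caseBool (Q z)
      (λ qz → cong₂ [_]·_
         (sym (cong₂ _∧_ (region-le-exact i∈Q qz) (region-le-exact qz qw))) (G-inside qz))
      (λ qz → trans ([]·-zero (closedInterval i w z) (G-outside qz))
         (sym (if-false (¬true (λ z∈[i,w] →
            true≢false (region-le-inside (∧-l {regionLe P c v i z} z∈[i,w]) i∈Q) qz)))))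

  -- elements covering i in P and lying in the region cover i there too
  G-cover : ∀ x → Q x ≡ true → edge P i x ≡ true → G x ≡ - 1ℤ
  G-cover x qx e = trans (G-inside qx) (row-cover (möbius (regionLe P c v) i) möbius-row x
    (region-le-complete i∈Q qx (edge-le e)) (edge-ne e)
    (λ k i≤k k≤x → edge-covers e (region-le-sound i≤k) (region-le-sound k≤x)))

  -- [i, x] with x outside the region: if the chain meets (i, x], then the
  -- region part of [i, x] is that of [i, w] for the largest chain vertex w
  -- below x, so the sum vanishes
  G-beyond-chain : ∀ x → Q x ≡ false → chainAbove i x ≡ true → Σ[ closedInterval i x ] G ≡ 0ℤ
  G-beyond-chain x qx above with chainAbove-elim above
  ... | u , u∈c , i<u , u≤x with chain-max-below u∈c u≤x
  ...   | w , w∈c , w≤x , max = trans (Σ-subset (closedInterval i x) (closedInterval i w) G same-support)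
            (G-interval w (chain⊆region w∈c) i<w)
    where
    i<w : ltᵇ P i w ≡ true
    i<w = lt-intro (le-trans (lt-le i<u) (max u u∈c u≤x))
      (λ { refl → lt-ne i<u (le-anti (lt-le i<u) (max u u∈c u≤x)) })
    z≤x⇔z≤w : ∀ z → Q z ≡ true → leᵇ P z x ≡ leᵇ P z w
    z≤x⇔z≤w z qz = bool-ext
      (λ z≤x → let (u' , u'∈c , z≤u' , u'≤x) = exit qz qx z≤x in le-trans z≤u' (max u' u'∈c u'≤x))
      (λ z≤w → le-trans z≤w w≤x)
    same-support : ∀ z → G z ≢ 0ℤ → closedInterval i x z ≡ closedInterval i w z
    same-support z Gz≢0 = cong (leᵇ P i z ∧_) (z≤x⇔z≤w z (G-support Gz≢0))

  -- otherwise the region part of [i, x] is {i} alone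
  G-beyond-no-chain : ∀ x → Q x ≡ false → ltᵇ P i x ≡ true → chainAbove i x ≡ false →
    Σ[ closedInterval i x ] G ≡ 1ℤ
  G-beyond-no-chain x qx i<x no-chain =
    trans (Σ-single (closedInterval i x) G i (∧-intro (le-refl i) (lt-le i<x)) only-i) G-start
    where
    only-i : ∀ z → closedInterval i x z ≡ true → z ≢ i → G z ≡ 0ℤ
    only-i z z∈[i,x] z≢i = caseBool (Q z) inside G-outside
      where
      i≤z : leᵇ P i z ≡ true
      i≤z = ∧-l {leᵇ P i z} z∈[i,x]
      inside : Q z ≡ true → G z ≡ 0ℤ
      inside qz with exit qz qx (∧-r {leᵇ P i z} z∈[i,x])
      ... | u , u∈c , z≤u , u≤x = ⊥-elim (z≢i (le-anti (subst (λ t → leᵇ P z t ≡ true) u≡i z≤u) i≤z))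
        where
        u≡i : u ≡ i
        u≡i with u FinP.≟ i
        ... | yes u≡i = u≡i
        ... | no u≢i = ⊥-elim (true≢false
          (chainAbove-intro u u∈c (lt-intro (le-trans i≤z z≤u) (u≢i ∘ sym)) u≤x) no-chain)

cancel : ∀ N → (1ℤ + - N) + (N + - 1ℤ) ≡ 0ℤ
cancel = solve-∀

balance : ∀ (b : Bool) (N : ℤ) → [ not b ]· (N + - 1ℤ) + ((1ℤ + - N) + [ b ]· (N + - 1ℤ)) ≡ 0ℤ
balance true N = trans (ℤP.+-identityˡ ((1ℤ + - N) + (N + - 1ℤ))) (cancel N)
balance false N = trans (cong ((N + - 1ℤ) +_) (ℤP.+-identityʳ (1ℤ + - N)))
  (trans (ℤP.+-comm (N + - 1ℤ) (1ℤ + - N)) (cancel N))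

start-identity : ∀ N → 1ℤ ≡ N + ((1ℤ + - N) + 0ℤ)
start-identity = solve-∀

chain-cover-identity : ∀ N → - 1ℤ ≡ - N + (0ℤ + (N + - 1ℤ))
chain-cover-identity = solve-∀

one-less : ∀ a → a ≡ (a + 1ℤ) + - 1ℤ
one-less = solve-∀

module MainArgument {m : ℕ} (P : FinPoset m) (c : Chain P) (i : Fin m) where
  open PosetFacts P
  open ChainFacts P c
  open ComponentFacts P c
  open MöbiusRow (leᵇ P) le-refl le-trans le-anti i using (IsMöbiusRow; row-unique)

  F : Fin m → ℤ
  F z = if i == z then 1ℤ else if edge P i z then - 1ℤ else regionSum P c i z

  region-row-without-i : ∀ v z → inRegion P c v i ≡ false → μRegion P c v i z ≡ 0ℤ
  region-row-without-i v z i∉Q = if-false (cong (_∧ inRegion P c v z) i∉Q)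

  regionSum-not-above : ∀ z → leᵇ P i z ≡ false → regionSum P c i z ≡ 0ℤ
  regionSum-not-above z i≰z = Σ-zero (isRep P c) (λ v _ → caseBool (inRegion P c v i)
    (λ i∈Q → RegionMöbius.G-not-above P c v i i∈Q z i≰z)
    (region-row-without-i v z))

  F-not-above : ∀ j → leᵇ P i j ≡ false → F j ≡ 0ℤ
  F-not-above j i≰j =
    trans (if-false (≢→== {a = i} {j} λ { refl → true≢false (le-refl i) i≰j }))
    (trans (if-false (¬true (λ e → true≢false (edge-le e) i≰j))) (regionSum-not-above j i≰j))

  -- i off the chain: only the region of i's component contributes, and F
  -- is its Möbius row
  module OffChain (i∉c : inVc c i ≡ false) where
    v₀ : Fin m
    v₀ = proj₁ (rep-exists i∉c)
    rep₀ : isRep P c v₀ ≡ true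
    rep₀ = proj₁ (proj₂ (rep-exists i∉c))
    i∈H₀ : inComp P c v₀ i ≡ true
    i∈H₀ = proj₂ (proj₂ (rep-exists i∉c))

    i∈Q₀ : inRegion P c v₀ i ≡ true
    i∈Q₀ = ∨-introˡ i∈H₀

    open RegionOrder P c v₀ using (Q; neighbour-in-region; exit)
    open RegionMöbius P c v₀ i i∈Q₀

    regionSum≡G : ∀ z → regionSum P c i z ≡ G z
    regionSum≡G z = sum-over-reps rep₀ i∈H₀ (λ v → μRegion P c v i z)
      (λ v _ i∉H → region-row-without-i v z (∨-false-intro i∉H i∉c))

    F≡G : ∀ z → F z ≡ G z
    F≡G z = caseBool (i == z)
      (λ i=z → trans (if-true i=z) (trans (sym G-start) (cong G (==→≡ i=z))))
      (λ i≠z → trans (if-false i≠z) (caseBool (edge P i z)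
        (λ e → trans (if-true e) (sym (G-cover z (neighbour-in-region i∈Q₀ i∉c (inj₁ e)) e)))
        (λ ¬e → trans (if-false ¬e) (regionSum≡G z))))

    interval-sum : ∀ j → leᵇ P i j ≡ true → i ≢ j → Σ[ closedInterval i j ] F ≡ 0ℤ
    interval-sum j i≤j i≢j = trans (Σ-cong (closedInterval i j) (λ z _ → F≡G z))
      (caseBool (Q j) (λ qj → G-interval j qj (lt-intro i≤j i≢j))
                      (λ qj → G-beyond-chain j qj (chain-between qj)))
      where
      chain-between : Q j ≡ false → chainAbove i j ≡ true
      chain-between qj with exit i∈Q₀ qj i≤j
      ... | u , u∈c , i≤u , u≤j =
        chainAbove-intro u u∈c (lt-intro i≤u (λ { refl → true≢false u∈c i∉c })) u≤j

  -- i on the chain: i lies in every region; F is the sum of the region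
  -- rows plus a correction at i and at the chain successor of i
  module OnChain (i∈c : inVc c i ≡ true) where
    i∈region : ∀ v → inRegion P c v i ≡ true
    i∈region v = ∨-introʳ {inComp P c v i} i∈c

    module R (v : Fin m) = RegionMöbius P c v i (i∈region v)

    regions : ℤ
    regions = Σ[ isRep P c ] (λ _ → 1ℤ)

    regionSum-start : regionSum P c i i ≡ regions
    regionSum-start = Σ-cong (isRep P c) (λ v _ → R.G-start v)

    regionSum-chain-cover : ∀ z → inVc c z ≡ true → edge P i z ≡ true → regionSum P c i z ≡ - regions
    regionSum-chain-cover z z∈c e =
      trans (Σ-cong (isRep P c) (λ v _ → R.G-cover v z (∨-introʳ {inComp P c v z} z∈c) e))
            (Σ-neg (isRep P c) (λ _ → 1ℤ))

    regionSum-cover-off-chain : ∀ z → inVc c z ≡ false → edge P i z ≡ true → regionSum P c i z ≡ - 1ℤ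
    regionSum-cover-off-chain z z∉c e with rep-exists z∉c
    ... | v , rep , z∈H = trans
      (sum-over-reps rep z∈H (λ v' → μRegion P c v' i z)
        (λ v' _ z∉H' → R.G-outside v' (∨-false-intro z∉H' z∉c)))
      (R.G-cover v z (∨-introˡ z∈H) e)

    -- F exceeds the sum of the region rows by 1 - N at i and by N - 1 at
    -- the chain successor of i (where each of the N region rows is -1)
    correction : Fin m → ℤ
    correction z = [ i == z ]· (1ℤ + - regions) + [ inVc c z ∧ edge P i z ]· (regions + - 1ℤ)

    F-decomposition : ∀ z → F z ≡ regionSum P c i z + correction z
    F-decomposition z = caseBool (i == z) at-i off-i
      where
      at-i : i == z ≡ true → F z ≡ regionSum P c i z + correction z
      at-i i=z with ==→≡ i=z
      ... | refl = trans (if-true i=z) (trans (start-identity regions)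
        (sym (cong₂ _+_ regionSum-start (cong₂ _+_ (if-true i=z)
          (if-false (¬true (λ h → edge-ne (∧-r {inVc c i} h) refl)))))))
      off-i : i == z ≡ false → F z ≡ regionSum P c i z + correction z
      off-i i≠z = trans (if-false i≠z) (caseBool (edge P i z)
        (λ e → trans (if-true e) (cover e)) (λ ¬e → trans (if-false ¬e) (non-cover ¬e)))
        where
        no-start : [ i == z ]· (1ℤ + - regions) ≡ 0ℤ
        no-start = if-false {x = 1ℤ + - regions} {0ℤ} i≠z
        cover : edge P i z ≡ true → - 1ℤ ≡ regionSum P c i z + correction z
        cover e = caseBool (inVc c z)
          (λ z∈c → trans (chain-cover-identity regions)
            (sym (cong₂ _+_ (regionSum-chain-cover z z∈c e) (cong₂ _+_ no-start (if-true (∧-intro z∈c e))))))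
          (λ z∉c → sym (cong₂ _+_ (regionSum-cover-off-chain z z∉c e)
            (cong₂ _+_ no-start (if-false (cong (_∧ edge P i z) z∉c)))))
        non-cover : edge P i z ≡ false → regionSum P c i z ≡ regionSum P c i z + correction z
        non-cover ¬e = sym (trans (cong (regionSum P c i z +_)
          (cong₂ _+_ no-start (if-false (trans (cong (inVc c z ∧_) ¬e) (∧-zeroʳ (inVc c z))))))
          (ℤP.+-identityʳ _))

    correction-interval-sum : ∀ x → ltᵇ P i x ≡ true →
      Σ[ closedInterval i x ] correction ≡ (1ℤ + - regions) + [ chainAbove i x ]· (regions + - 1ℤ)
    correction-interval-sum x i<x = trans (Σ-+ (closedInterval i x) _ _) (cong₂ _+_ start-term successor-term)
      where
      start-term : Σ[ closedInterval i x ] (λ z → [ i == z ]· (1ℤ + - regions)) ≡ 1ℤ + - regions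
      start-term = trans (Σ-single (closedInterval i x) _ i (∧-intro (le-refl i) (lt-le i<x))
          (λ z _ z≢i → if-false (≢→== (z≢i ∘ sym))))
        (if-true (==-refl i))
      successor-term : Σ[ closedInterval i x ] (λ z → [ inVc c z ∧ edge P i z ]· (regions + - 1ℤ))
        ≡ [ chainAbove i x ]· (regions + - 1ℤ)
      successor-term = caseBool (chainAbove i x)
        (λ above → let (z₀ , z₀∈c , e₀ , z₀≤x) = chain-successor i∈c above in
          trans (Σ-single (closedInterval i x) _ z₀ (∧-intro (edge-le e₀) z₀≤x)
                  (λ z _ z≢z₀ → if-false (¬true (λ h →
                    z≢z₀ (chain-cover-unique (∧-l {inVc c z} h) z₀∈c (∧-r {inVc c z} h) e₀)))))
                (trans (if-true (∧-intro z₀∈c e₀)) (sym (if-true above))))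
        (λ none → trans (Σ-zero (closedInterval i x) (λ z z∈[i,x] → if-false (¬true (λ h →
                    true≢false (chainAbove-intro z (∧-l {inVc c z} h) (edge-lt (∧-r {inVc c z} h))
                                 (∧-r {leᵇ P i z} z∈[i,x])) none))))
                  (sym (if-false none)))

    region-interval-sum : ∀ v x → ltᵇ P i x ≡ true →
      Σ[ closedInterval i x ] (R.G v) ≡ [ not (inRegion P c v x) ∧ not (chainAbove i x) ]· 1ℤ
    region-interval-sum v x i<x with inRegion P c v x in qx | chainAbove i x in above
    ... | true | _ = R.G-interval v x qx i<x
    ... | false | true = R.G-beyond-chain v x qx above
    ... | false | false = R.G-beyond-no-chain v x qx i<x above

    -- a vertex off the chain misses all regions but its own
    regions-missing : ∀ x → inVc c x ≡ false →
      Σ[ isRep P c ] (λ v → [ not (inRegion P c v x) ]· 1ℤ) ≡ regions + - 1ℤ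
    regions-missing x x∉c with rep-exists x∉c
    ... | v , rep , x∈H = trans (one-less _) (cong (_+ - 1ℤ) (sym split))
      where
      one-or-other : ∀ b → 1ℤ ≡ [ not b ]· 1ℤ + [ b ]· 1ℤ
      one-or-other true = refl
      one-or-other false = refl
      containing : Σ[ isRep P c ] (λ v → [ inRegion P c v x ]· 1ℤ) ≡ 1ℤ
      containing = trans (sum-over-reps rep x∈H _ (λ v' _ x∉H' → if-false (∨-false-intro x∉H' x∉c)))
        (if-true (∨-introˡ x∈H))
      split : regions ≡ Σ[ isRep P c ] (λ v → [ not (inRegion P c v x) ]· 1ℤ) + 1ℤ
      split = trans (Σ-cong (isRep P c) (λ v _ → one-or-other (inRegion P c v x)))
        (trans (Σ-+ (isRep P c) (λ v → [ not (inRegion P c v x) ]· 1ℤ) (λ v → [ inRegion P c v x ]· 1ℤ))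
               (cong (Σ[ isRep P c ] (λ v → [ not (inRegion P c v x) ]· 1ℤ) +_) containing))

    shares-total : ∀ x → ltᵇ P i x ≡ true →
      Σ[ isRep P c ] (λ v → [ not (inRegion P c v x) ∧ not (chainAbove i x) ]· 1ℤ)
        ≡ [ not (chainAbove i x) ]· (regions + - 1ℤ)
    shares-total x i<x with chainAbove i x in above
    ... | true = Σ-zero (isRep P c) (λ v _ → cong ([_]· 1ℤ) (∧-zeroʳ (not (inRegion P c v x))))
    ... | false = trans (Σ-cong (isRep P c) (λ v _ → cong ([_]· 1ℤ) (∧-identityʳ (not (inRegion P c v x)))))
                        (regions-missing x x∉c)
      where
      x∉c : inVc c x ≡ false
      x∉c = ¬true (λ x∈c → true≢false (chainAbove-intro x x∈c i<x (le-refl x)) above)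

    regionSum-interval-sum : ∀ x → ltᵇ P i x ≡ true →
      Σ[ closedInterval i x ] (regionSum P c i) ≡ [ not (chainAbove i x) ]· (regions + - 1ℤ)
    regionSum-interval-sum x i<x = begin
        Σ[ closedInterval i x ] (λ z → Σ[ isRep P c ] (λ v → μRegion P c v i z))
      ≡⟨ Σ-swap (closedInterval i x) (isRep P c) (λ z v → μRegion P c v i z) ⟩
        Σ[ isRep P c ] (λ v → Σ[ closedInterval i x ] (R.G v))
      ≡⟨ Σ-cong (isRep P c) (λ v _ → region-interval-sum v x i<x) ⟩
        Σ[ isRep P c ] (λ v → [ not (inRegion P c v x) ∧ not (chainAbove i x) ]· 1ℤ)
      ≡⟨ shares-total x i<x ⟩
        [ not (chainAbove i x) ]· (regions + - 1ℤ) ∎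
      where open ≡-Reasoning

    interval-sum : ∀ j → leᵇ P i j ≡ true → i ≢ j → Σ[ closedInterval i j ] F ≡ 0ℤ
    interval-sum j i≤j i≢j = begin
        Σ[ closedInterval i j ] F
      ≡⟨ Σ-cong (closedInterval i j) (λ z _ → F-decomposition z) ⟩
        Σ[ closedInterval i j ] (λ z → regionSum P c i z + correction z)
      ≡⟨ Σ-+ (closedInterval i j) (regionSum P c i) correction ⟩
        Σ[ closedInterval i j ] (regionSum P c i) + Σ[ closedInterval i j ] correction
      ≡⟨ cong₂ _+_ (regionSum-interval-sum j i<j) (correction-interval-sum j i<j) ⟩
        [ not (chainAbove i j) ]· (regions + - 1ℤ) + ((1ℤ + - regions) + [ chainAbove i j ]· (regions + - 1ℤ))
      ≡⟨ balance (chainAbove i j) regions ⟩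
        0ℤ ∎
      where
      open ≡-Reasoning
      i<j : ltᵇ P i j ≡ true
      i<j = lt-intro i≤j i≢j

  F-row : IsMöbiusRow F
  F-row = record
    { at-start = if-true (==-refl i)
    ; off-interval = F-not-above
    ; interval-sum = λ j → caseBool (inVc c i) (λ i∈c → OnChain.interval-sum i∈c j)
                                               (λ i∉c → OffChain.interval-sum i∉c j)
    }

  μ≡F : ∀ j → μ P i j ≡ F j
  μ≡F = row-unique F F-row

mainTheorem13 : ∀ {m : ℕ} (P : FinPoset m) (c : Chain P) (i j : Fin m) → i ≢ j →
    (edge P i j ≡ true → μ P i j ≡ - 1ℤ)
    × (edge P i j ≡ false → μ P i j ≡ regionSum P c i j)
mainTheorem13 P c i j i≢j =
    (λ e → trans μ≡F (trans F-at-j (if-true e)))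
  , (λ ¬e → trans μ≡F (trans F-at-j (if-false ¬e)))
  where
  μ≡F : μ P i j ≡ MainArgument.F P c i j
  μ≡F = MainArgument.μ≡F P c i j
  F-at-j : MainArgument.F P c i j ≡ (if edge P i j then - 1ℤ else regionSum P c i j)
  F-at-j = if-false (≢→== i≢j)
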